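{- Let $G$ be a cograph whose Dilworth number satisfies $\nabla(G)=k\ge 2$. Then there exists a partition of $V(G)$ into $k$ sets such that the subgraph of $G$ induced by each set is a threshold graph, and for one of these parts, say with induced subgraph $H$, all vertices of $H$ have the same neighborhood in $G-V(H)$; that is, for all $u,w\in V(H)$ we have $N_G(u)\setminus V(H)=N_G(w)\setminus V(H)$.
   Context: All graphs are finite, simple and undirected. A cograph is a graph containing no induced path on 4 vertices. A threshold graph is a graph that is both a cograph and a split graph, where a split graph is one whose vertex set can be partitioned into a clique and a coclique. For a vertex $v$, $N_G(v)$ is the set of neighbors of $v$ (open neighborhood) and $N_G[v]=N_G(v)\cup\{v\}$ (closed neighborhood). The vicinal preorder on $V(G)$ is defined by $u\prec v$ if and only if $N_G(u)\subseteq N_G[v]$; it is reflexive and transitive. A chain is a set of vertices any two of which are comparable under $\prec$. The Dilworth number $\nabla(G)$ is the minimum number of chains needed to cover $V(G)$ (equivalently, the maximum size of an antichain). For $X\subseteq V(G)$, $G-X$ denotes the subgraph induced by $V(G)\setminus X$. -}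

module Defs where

open import Data.Nat using (ℕ; _<_)
open import Data.Fin using (Fin)
open import Data.Bool using (Bool; true; false)
open import Data.Product using (Σ; Σ-syntax; _×_; _,_; proj₁; ∃-syntax)
open import Data.Sum using (_⊎_)
open import Relation.Nullary using (¬_)
open import Relation.Binary.PropositionalEquality using (_≡_)

record Graph (V : Set) : Set where
  field
    adj    : V → V → Bool
    sym    : ∀ u v → adj u v ≡ adj v u
    irrefl : ∀ v → adj v v ≡ false
open Graph public

Edge : ∀ {V} → Graph V → V → V → Set
Edge G u v = adj G u v ≡ true

NonEdge : ∀ {V} → Graph V → V → V → Set
NonEdge G u v = adj G u v ≡ false

induced : ∀ {V} → Graph V → (S : V → Set) → Graph (Σ V S)
induced G S = record
  { adj    = λ u v → adj G (proj₁ u) (proj₁ v)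
  ; sym    = λ u v → sym G (proj₁ u) (proj₁ v)
  ; irrefl = λ v → irrefl G (proj₁ v) }

-- An induced path a-b-c-d on 4 vertices (distinctness of a,b,c,d is
-- forced by the edge/non-edge pattern and irreflexivity).
InducedP4 : ∀ {V} → Graph V → V → V → V → V → Set
InducedP4 G a b c d =
  Edge G a b × Edge G b c × Edge G c d ×
  NonEdge G a c × NonEdge G b d × NonEdge G a d

Cograph : ∀ {V} → Graph V → Set
Cograph {V} G = ∀ (a b c d : V) → ¬ InducedP4 G a b c d

Split : ∀ {V} → Graph V → Set
Split {V} G = Σ[ K ∈ (V → Bool) ]
  ((∀ u v → K u ≡ true → K v ≡ true → ¬ u ≡ v → Edge G u v) ×
   (∀ u v → K u ≡ false → K v ≡ false → NonEdge G u v))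

Threshold : ∀ {V} → Graph V → Set
Threshold G = Cograph G × Split G

Vicinal : ∀ {V} → Graph V → V → V → Set
Vicinal {V} G u v = ∀ (x : V) → Edge G u x → (x ≡ v ⊎ Edge G v x)

-- A cover of V by k chains (some chains may be empty): each vertex is
-- assigned a chain index, and vertices in the same chain are comparable.
ChainCover : ∀ {V} → Graph V → ℕ → Set
ChainCover {V} G k = Σ[ c ∈ (V → Fin k) ]
  (∀ u v → c u ≡ c v → Vicinal G u v ⊎ Vicinal G v u)

DilworthNumber : ∀ {V} → Graph V → ℕ → Set
DilworthNumber G k = ChainCover G k × (∀ m → m < k → ¬ ChainCover G m)

-- Every colour class of a chain cover induces a threshold graph (a chain of
-- the vicinal preorder is a split graph, and induced subgraphs of cographs
-- are cographs), and a cover by ∇(G) chains uses every colour.  So it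
-- suffices to find a chain cover with k colours and a nonempty module W that
-- is a chain and a union of colour classes: recolouring W with a single
-- colour then yields the partition.
--
-- W is found by descending through modules.  We keep a module W that is a
-- union of colour classes and a nonempty submodule X of W whose complement
-- in W is comparable with all of W.  While X is not a chain, either some
-- vertex of X is isolated or universal in G[X] (it is comparable with all of
-- W, and is removed from X), or, G[X] being a cograph on ≥ 2 vertices, X
-- splits into two homogeneously joined parts A and X ∖ A with no
-- comparabilities between them; then X ∖ A becomes the new W = X, after the
-- settled vertices W ∖ X are recoloured with the colour of a vertex of A.
-- X shrinks strictly at each step, so the descent terminates.
module Submission where

open import Defs hiding (sym)
open import Data.Nat using (ℕ; zero; suc; _<_; _≤_; s≤s; z≤n)
open import Data.Nat.Properties using (n<1+n; <-≤-trans)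
open import Data.Bool using (Bool; true; false; not; if_then_else_)
open import Data.Bool.Properties using (¬-not) renaming (_≟_ to _≟ᵇ_)
open import Data.Fin using (Fin; zero; punchOut; _≟_)
open import Data.Fin.Properties using (any?; all?; punchOut-injective)
open import Data.Fin.Subset using (Subset; _∈_; _∉_; _⊆_; _⊂_; ⊤; ⁅_⁆; _∩_; _∪_; ∁)
open import Data.Fin.Subset.Properties
  using (_∈?_; ∈⊤; x∈⁅x⁆; x∈⁅y⁆⇒x≡y; x≢y⇒x∉⁅y⁆; x∉⁅y⁆⇒x≢y; x∈p∩q⁺; x∈p∩q⁻;
         x∈p∪q⁺; x∈p∪q⁻; x∉p⇒x∈∁p; x∈∁p⇒x∉p)
open import Data.Fin.Subset.Induction using (⊂-wellFounded)
open import Data.Vec using (tabulate)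
open import Data.Vec.Properties using (lookup∘tabulate; lookup⇒[]=; []=⇒lookup)
open import Data.Product using (Σ; Σ-syntax; ∃-syntax; _×_; _,_; proj₁; proj₂)
open import Data.Sum using (_⊎_; inj₁; inj₂; [_,_]′) renaming (swap to ⊎-swap)
open import Data.Empty using (⊥; ⊥-elim)
open import Function using (_∘_)
open import Function.Definitions using (Surjective)
open import Induction.WellFounded using (Acc; acc)
open import Relation.Nullary using (¬_; Dec; yes; no; does; contradiction)
open import Relation.Nullary.Decidable
  using (_×-dec_; _⊎-dec_; _→-dec_; ¬?; dec-true; decidable-stable)
open import Relation.Binary.PropositionalEquality
  using (_≡_; _≢_; refl; sym; trans; cong)
open import Axiom.UniquenessOfIdentityProofs using (module Decidable⇒UIP)

module _ {n : ℕ} (G : Graph (Fin n)) where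

  private
    variable
      k : ℕ
      t u v w x y z : Fin n

  adj-sym : ∀ u v → adj G u v ≡ adj G v u
  adj-sym = Graph.sym G

  Comparable : Fin n → Fin n → Set
  Comparable u v = Vicinal G u v ⊎ Vicinal G v u

  vicinal? : ∀ u v → Dec (Vicinal G u v)
  vicinal? u v = all? λ x → adj G u x ≟ᵇ true →-dec ((x ≟ v) ⊎-dec (adj G v x ≟ᵇ true))

  comparable? : ∀ u v → Dec (Comparable u v)
  comparable? u v = vicinal? u v ⊎-dec vicinal? v u

  comparable-refl : ∀ u → Comparable u u
  comparable-refl u = inj₁ λ x ux → inj₂ ux

  IsChainCover : (Fin n → Fin k) → Set
  IsChainCover c = ∀ u v → c u ≡ c v → Comparable u v

  IsModule : Subset n → Set
  IsModule M = ∀ u w x → u ∈ M → w ∈ M → x ∉ M → adj G u x ≡ adj G w x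

  ColourClosed : (Fin n → Fin k) → Subset n → Set
  ColourClosed c W = ∀ u w → c u ≡ c w → u ∈ W → w ∈ W

  Isolated Universal Extreme : Subset n → Fin n → Set
  Isolated X t = ∀ y → y ∈ X → adj G t y ≡ false
  Universal X t = ∀ y → y ∈ X → y ≢ t → adj G t y ≡ true
  Extreme X t = Isolated X t ⊎ Universal X t

  extreme? : ∀ X t → Dec (Extreme X t)
  extreme? X t =
    all? (λ y → y ∈? X →-dec adj G t y ≟ᵇ false) ⊎-dec
    all? (λ y → y ∈? X →-dec ¬? (y ≟ t) →-dec adj G t y ≟ᵇ true)

  incomparable-pair? : ∀ X → Dec (∃[ u ] ∃[ v ] (u ∈ X × v ∈ X × ¬ Comparable u v))
  incomparable-pair? X = any? λ u → any? λ v → u ∈? X ×-dec v ∈? X ×-dec ¬? (comparable? u v)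

  extreme-vertex? : ∀ X → Dec (∃[ t ] (t ∈ X × Extreme X t))
  extreme-vertex? X = any? λ t → t ∈? X ×-dec extreme? X t

  _∖_ : Subset n → Subset n → Subset n
  X ∖ A = X ∩ ∁ A

  ∖⁺ : ∀ {X A} → x ∈ X → x ∉ A → x ∈ X ∖ A
  ∖⁺ x∈X x∉A = x∈p∩q⁺ (x∈X , x∉p⇒x∈∁p x∉A)

  ∖⁻ : ∀ {X A} → x ∈ X ∖ A → x ∈ X × x ∉ A
  ∖⁻ {X = X} {A} h with x∈p∩q⁻ X (∁ A) h
  ... | x∈X , x∈∁A = x∈X , x∈∁p⇒x∉p x∈∁A

  ∖-⊂ : ∀ {X A} → x ∈ X → x ∈ A → X ∖ A ⊂ X
  ∖-⊂ {x = x} x∈X x∈A = proj₁ ∘ ∖⁻ , x , x∈X , λ h → proj₂ (∖⁻ h) x∈A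

  ∖-⁅⁆⁺ : ∀ {X} → x ∈ X → x ≢ v → x ∈ X ∖ ⁅ v ⁆
  ∖-⁅⁆⁺ x∈X x≢v = ∖⁺ x∈X (x≢y⇒x∉⁅y⁆ x≢v)

  ∖-⁅⁆⁻ : ∀ {X} → x ∈ X ∖ ⁅ v ⁆ → x ∈ X × x ≢ v
  ∖-⁅⁆⁻ h with ∖⁻ h
  ... | x∈X , x∉v = x∈X , x∉⁅y⁆⇒x≢y x∉v

  select : {P : Fin n → Set} → (∀ y → Dec (P y)) → Subset n
  select P? = tabulate (does ∘ P?)

  select⁺ : {P : Fin n → Set} (P? : ∀ y → Dec (P y)) → P y → y ∈ select P?
  select⁺ {y = y} P? py =
    lookup⇒[]= y (select P?) (trans (lookup∘tabulate (does ∘ P?) y) (dec-true (P? y) py))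

  select⁻ : {P : Fin n → Set} (P? : ∀ y → Dec (P y)) → y ∈ select P? → P y
  select⁻ {y = y} P? h with P? y | trans (sym (lookup∘tabulate (does ∘ P?) y)) ([]=⇒lookup h)
  ... | yes py | _ = py
  ... | no _ | ()

  induced-cograph : Cograph G → (S : Fin n → Set) → Cograph (induced G S)
  induced-cograph cograph S a b c d = cograph (proj₁ a) (proj₁ b) (proj₁ c) (proj₁ d)

  -- Vertices with a neighbour below them in the vicinal preorder; in a chain
  -- they form the clique side of a split partition.
  HasLowerNeighbour : Fin n → Set
  HasLowerNeighbour v = ∃[ w ] (Edge G v w × Vicinal G w v)

  hasLowerNeighbour? : ∀ v → Dec (HasLowerNeighbour v)
  hasLowerNeighbour? v = any? λ w → adj G v w ≟ᵇ true ×-dec vicinal? w v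

  lower-adjacent : Vicinal G u v → u ≢ v → HasLowerNeighbour u → Edge G u v
  lower-adjacent {u} {v} u≺v u≢v (w , uw , w≺u) with u≺v w uw
  ... | inj₁ refl = uw
  ... | inj₂ vw with w≺u v (trans (adj-sym w v) vw)
  ...   | inj₁ v≡u = contradiction (sym v≡u) u≢v
  ...   | inj₂ uv = uv

  upper-has-lower : Vicinal G u v → Edge G u v → HasLowerNeighbour v
  upper-has-lower {u} {v} u≺v uv = u , trans (adj-sym v u) uv , u≺v

  chain-split : (S : Fin n → Set) → (∀ v (s s′ : S v) → s ≡ s′) →
                (∀ u v → S u → S v → Comparable u v) → Split (induced G S)
  chain-split S S-irrelevant chain = K , clique , coclique
    where
    K : Σ (Fin n) S → Bool
    K (v , _) = does (hasLowerNeighbour? v)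

    Σ-≡ : ∀ (p q : Σ (Fin n) S) → proj₁ p ≡ proj₁ q → p ≡ q
    Σ-≡ (v , s) (.v , s′) refl = cong (v ,_) (S-irrelevant v s s′)

    comparable : ∀ (p q : Σ (Fin n) S) → Comparable (proj₁ p) (proj₁ q)
    comparable (u , su) (v , sv) = chain u v su sv

    clique : ∀ p q → K p ≡ true → K q ≡ true → p ≢ q → Edge G (proj₁ p) (proj₁ q)
    clique p@(u , _) q@(v , _) Kp Kq p≢q
      with hasLowerNeighbour? u | hasLowerNeighbour? v | comparable p q
    ... | yes lu | _ | inj₁ u≺v = lower-adjacent u≺v (p≢q ∘ Σ-≡ p q) lu
    ... | _ | yes lv | inj₂ v≺u =
      trans (adj-sym u v) (lower-adjacent v≺u (p≢q ∘ sym ∘ Σ-≡ q p) lv)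
    -- (in the remaining cases Kp or Kq reduces to false ≡ true)

    coclique : ∀ p q → K p ≡ false → K q ≡ false → NonEdge G (proj₁ p) (proj₁ q)
    coclique p@(u , _) q@(v , _) Kp Kq with adj G u v in uv
    ... | false = refl
    ... | true with hasLowerNeighbour? u | hasLowerNeighbour? v | comparable p q
    ...   | _ | no ¬lv | inj₁ u≺v = contradiction (upper-has-lower u≺v uv) ¬lv
    ...   | no ¬lu | _ | inj₂ v≺u =
      contradiction (upper-has-lower v≺u (trans (adj-sym v u) uv)) ¬lu

  chainCover-threshold : Cograph G → (c : Fin n → Fin k) → IsChainCover c →
                         ∀ i → Threshold (induced G (λ v → c v ≡ i))
  chainCover-threshold cograph c chains i =
    induced-cograph cograph _ ,
    chain-split _ (λ _ → Decidable⇒UIP.≡-irrelevant _≟_)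
                  (λ u v cu cv → chains u v (trans cu (sym cv)))

  -- A cover by the minimum number of chains uses every colour: otherwise the
  -- colours could be compressed into fewer chains.
  minimum-cover-surjective : (∀ m → m < k → ¬ ChainCover G m) →
                             (c : Fin n → Fin k) → IsChainCover c →
                             Surjective _≡_ _≡_ c
  minimum-cover-surjective {suc k′} minimum c chains i
    with any? (λ v → c v ≟ i)
  ... | yes (v , cv≡i) = v , λ { refl → cv≡i }
  ... | no missed = contradiction (compressed , compressed-chains) (minimum k′ (n<1+n k′))
    where
    i≢c : ∀ v → i ≢ c v
    i≢c v i≡cv = missed (v , sym i≡cv)

    compressed : Fin n → Fin k′
    compressed v = punchOut (i≢c v)

    compressed-chains : IsChainCover compressed
    compressed-chains u v e = chains u v (punchOut-injective (i≢c u) (i≢c v) e)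

  recolour : Subset n → Fin k → (Fin n → Fin k) → Fin n → Fin k
  recolour R i c v = if does (v ∈? R) then i else c v

  recolour-∈ : ∀ {R} {i : Fin k} c → v ∈ R → recolour R i c v ≡ i
  recolour-∈ {v = v} {R} c v∈R with v ∈? R
  ... | yes _ = refl
  ... | no v∉R = contradiction v∈R v∉R

  recolour-∉ : ∀ {R} {i : Fin k} c → v ∉ R → recolour R i c v ≡ c v
  recolour-∉ {v = v} {R} c v∉R with v ∈? R
  ... | yes v∈R = contradiction v∈R v∉R
  ... | no _ = refl

  recolour-chains : ∀ {R} {i : Fin k} c → IsChainCover c →
                    (∀ r s → r ∈ R → s ∈ R → Comparable r s) →
                    (∀ r v → r ∈ R → c v ≡ i → Comparable r v) →
                    IsChainCover (recolour R i c)
  recolour-chains {R = R} c chains R-chain R-colour u v same with u ∈? R | v ∈? R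
  ... | yes u∈R | yes v∈R = R-chain u v u∈R v∈R
  ... | yes u∈R | no _ = R-colour u v u∈R (sym same)
  ... | no _ | yes v∈R = ⊎-swap (R-colour v u v∈R same)
  ... | no _ | no _ = chains u v same

  recolour-class : ∀ {R} {i : Fin k} c → (∀ v → c v ≡ i → v ∈ R) →
                   recolour R i c v ≡ i → v ∈ R
  recolour-class {v = v} {R} c R-colour recoloured with v ∈? R
  ... | yes v∈R = v∈R
  ... | no _ = R-colour v recoloured

  extreme-comparable : ∀ {X} → IsModule X → t ∈ X → Extreme X t → y ∈ X → Comparable t y
  extreme-comparable {t} {y} {X} X-module t∈X (inj₁ isolated) y∈X = inj₁ t≺y
    where
    t≺y : Vicinal G t y
    t≺y x tx with x ∈? X
    ... | yes x∈X = contradiction (trans (sym tx) (isolated x x∈X)) λ ()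
    ... | no x∉X = inj₂ (trans (sym (X-module t y x t∈X y∈X x∉X)) tx)
  extreme-comparable {t} {y} {X} X-module t∈X (inj₂ universal) y∈X = inj₂ y≺t
    where
    y≺t : Vicinal G y t
    y≺t x yx with x ≟ t | x ∈? X
    ... | yes x≡t | _ = inj₁ x≡t
    ... | no x≢t | yes x∈X = inj₂ (universal x x∈X x≢t)
    ... | no _ | no x∉X = inj₂ (trans (X-module t y x t∈X y∈X x∉X) yx)

  -- Removing an extreme vertex t of G[X] from a module X leaves a module:
  -- the rest of X sees t uniformly.
  module-minus-extreme : ∀ {X} → IsModule X → Extreme X t → IsModule (X ∖ ⁅ t ⁆)
  module-minus-extreme {t} {X} X-module extreme u w x u∈ w∈ x∉ with ∖-⁅⁆⁻ u∈ | ∖-⁅⁆⁻ w∈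
  ... | u∈X , u≢t | w∈X , w≢t with x ∈? X | x ≟ t
  ...   | no x∉X | _ = X-module u w x u∈X w∈X x∉X
  ...   | yes x∈X | no x≢t = contradiction (∖-⁅⁆⁺ x∈X x≢t) x∉
  ...   | yes _ | yes refl = sees-t-uniformly extreme
    where
    sees-t-uniformly : Extreme X t → adj G u t ≡ adj G w t
    sees-t-uniformly (inj₁ isolated) =
      trans (adj-sym u t) (trans (isolated u u∈X) (sym (trans (adj-sym w t) (isolated w w∈X))))
    sees-t-uniformly (inj₂ universal) =
      trans (adj-sym u t) (trans (universal u u∈X u≢t)
                                 (sym (trans (adj-sym w t) (universal w w∈X w≢t))))

  -- A partition of X into nonempty parts A and X ∖ A such that all
  -- adjacencies between the parts take the same value β; that is, G[X]
  -- (β = false) or its complement (β = true) is disconnected.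
  record HomogeneousSplit (X : Subset n) : Set where
    field
      A : Subset n
      A⊆X : A ⊆ X
      a : Fin n
      a∈A : a ∈ A
      b : Fin n
      b∈X : b ∈ X
      b∉A : b ∉ A
      β : Bool
      across : ∀ y z → y ∈ A → z ∈ X → z ∉ A → adj G y z ≡ β

  across-vicinal : ∀ {X} (P Q : Fin n → Set) (β : Bool) →
                   (∀ w → w ∈ X → P w ⊎ Q w) → (∀ p q → P p → Q q → adj G p q ≡ β) →
                   P y → Q z → Vicinal G y z → Isolated X y ⊎ Universal X z
  across-vicinal {y} {z} {X} P Q false cover across Py Qz y≺z = inj₁ isolated
    where
    isolated : Isolated X y
    isolated w w∈X with adj G y w in yw
    ... | false = refl
    ... | true with cover w w∈X
    ...   | inj₂ Qw = trans (sym yw) (across y w Py Qw)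
    ...   | inj₁ Pw with y≺z w yw
    ...     | inj₁ refl = trans (sym yw) (across y z Py Qz)
    ...     | inj₂ zw = trans (sym zw) (trans (adj-sym z w) (across w z Pw Qz))
  across-vicinal {y} {z} {X} P Q true cover across Py Qz y≺z = inj₂ universal
    where
    universal : Universal X z
    universal w w∈X w≢z with cover w w∈X
    ... | inj₁ Pw = trans (adj-sym z w) (across w z Pw Qz)
    ... | inj₂ Qw with y≺z w (across y w Py Qw)
    ...   | inj₁ w≡z = contradiction w≡z w≢z
    ...   | inj₂ zw = zw

  module _ {X : Subset n} (s : HomogeneousSplit X) where
    open HomogeneousSplit s

    split-incomparable : (∀ t → t ∈ X → ¬ Extreme X t) →
                         ∀ y z → y ∈ A → z ∈ X → z ∉ A → ¬ Comparable y z
    split-incomparable no-extreme y z y∈A z∈X z∉A = [ y-below-z , z-below-y ]′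
      where
      Rest : Fin n → Set
      Rest w = w ∈ X × w ∉ A

      cover : ∀ w → w ∈ X → w ∈ A ⊎ Rest w
      cover w w∈X with w ∈? A
      ... | yes w∈A = inj₁ w∈A
      ... | no w∉A = inj₂ (w∈X , w∉A)

      A-across : ∀ p q → p ∈ A → Rest q → adj G p q ≡ β
      A-across p q p∈A (q∈X , q∉A) = across p q p∈A q∈X q∉A

      Rest-across : ∀ p q → Rest p → q ∈ A → adj G p q ≡ β
      Rest-across p q (p∈X , p∉A) q∈A = trans (adj-sym p q) (across q p q∈A p∈X p∉A)

      y∈X : y ∈ X
      y∈X = A⊆X y∈A

      y-below-z : ¬ Vicinal G y z
      y-below-z y≺z with across-vicinal (_∈ A) Rest β cover A-across y∈A (z∈X , z∉A) y≺z
      ... | inj₁ isolated = no-extreme y y∈X (inj₁ isolated)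
      ... | inj₂ universal = no-extreme z z∈X (inj₂ universal)

      z-below-y : ¬ Vicinal G z y
      z-below-y z≺y
        with across-vicinal Rest (_∈ A) β (λ w → ⊎-swap ∘ cover w) Rest-across (z∈X , z∉A) y∈A z≺y
      ... | inj₁ isolated = no-extreme z z∈X (inj₁ isolated)
      ... | inj₂ universal = no-extreme y y∈X (inj₂ universal)

    split-module : IsModule X → IsModule (X ∖ A)
    split-module X-module u w x u∈ w∈ x∉ with ∖⁻ u∈ | ∖⁻ w∈ | x ∈? X | x ∈? A
    ... | u∈X , _ | w∈X , _ | no x∉X | _ = X-module u w x u∈X w∈X x∉X
    ... | _ | _ | yes x∈X | no x∉A = contradiction (∖⁺ x∈X x∉A) x∉
    ... | u∈X , u∉A | w∈X , w∉A | yes _ | yes x∈A =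
      trans (adj-sym u x) (trans (across x u x∈A u∈X u∉A)
                                 (sym (trans (adj-sym w x) (across x w x∈A w∈X w∉A))))

  record ModularChain (k : ℕ) : Set where
    field
      colour : Fin n → Fin k
      colour-chains : IsChainCover colour
      W : Subset n
      w₀ : Fin n
      w₀∈W : w₀ ∈ W
      W-module : IsModule W
      W-closed : ColourClosed colour W
      W-chain : ∀ u v → u ∈ W → v ∈ W → Comparable u v

  collapse : ModularChain k →
    Σ[ p ∈ (Fin n → Fin k) ]
      (IsChainCover p ×
       ∃[ i ] (∀ u w → p u ≡ i → p w ≡ i → ∀ x → p x ≢ i → adj G u x ≡ adj G w x))
  collapse {k} m = p , p-chains , colour w₀ , class-module
    where
    open ModularChain m

    colour-w₀⊆W : ∀ v → colour v ≡ colour w₀ → v ∈ W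
    colour-w₀⊆W v same = W-closed w₀ v (sym same) w₀∈W

    p : Fin n → Fin k
    p = recolour W (colour w₀) colour

    p-chains : IsChainCover p
    p-chains = recolour-chains colour colour-chains W-chain
                 (λ r v r∈W same → W-chain r v r∈W (colour-w₀⊆W v same))

    class-module : ∀ u w → p u ≡ colour w₀ → p w ≡ colour w₀ →
                   ∀ x → p x ≢ colour w₀ → adj G u x ≡ adj G w x
    class-module u w pu pw x px =
      W-module u w x (recolour-class colour colour-w₀⊆W pu)
                     (recolour-class colour colour-w₀⊆W pw) (px ∘ recolour-∈ colour)

  record Descent (k : ℕ) : Set where
    field
      colour : Fin n → Fin k
      colour-chains : IsChainCover colour
      W X : Subset n
      X⊆W : X ⊆ W
      W-module : IsModule W
      W-closed : ColourClosed colour W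
      X-module : IsModule X
      settled : ∀ s y → s ∈ W → s ∉ X → y ∈ W → Comparable s y
      x₀ : Fin n
      x₀∈X : x₀ ∈ X

  start : (c : Fin n → Fin k) → IsChainCover c → Fin n → Descent k
  start c chains x₀ = record
    { colour = c ; colour-chains = chains ; W = ⊤ ; X = ⊤ ; X⊆W = λ x∈⊤ → x∈⊤
    ; W-module = λ _ _ _ _ _ x∉⊤ → contradiction ∈⊤ x∉⊤ ; W-closed = λ _ _ _ _ → ∈⊤
    ; X-module = λ _ _ _ _ _ x∉⊤ → contradiction ∈⊤ x∉⊤
    ; settled = λ s _ _ s∉⊤ _ → contradiction ∈⊤ s∉⊤ ; x₀ = x₀ ; x₀∈X = ∈⊤ }

  finish : (d : Descent k) → (let open Descent d in ∀ u v → u ∈ X → v ∈ X → Comparable u v) →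
           ModularChain k
  finish d X-chain = record
    { colour = colour ; colour-chains = colour-chains ; W = W ; w₀ = x₀ ; w₀∈W = X⊆W x₀∈X
    ; W-module = W-module ; W-closed = W-closed ; W-chain = W-chain }
    where
    open Descent d

    W-chain : ∀ u v → u ∈ W → v ∈ W → Comparable u v
    W-chain u v u∈W v∈W with u ∈? X | v ∈? X
    ... | no u∉X | _ = settled u v u∈W u∉X v∈W
    ... | yes _ | no v∉X = ⊎-swap (settled v u v∈W v∉X u∈W)
    ... | yes u∈X | yes v∈X = X-chain u v u∈X v∈X

  -- An extreme vertex t of G[X] is comparable with all of W, so it can be
  -- settled: it leaves X, which shrinks.
  peel : (d : Descent k) → let open Descent d in
         t ∈ X → Extreme X t → u ∈ X → u ≢ t → Σ[ d′ ∈ Descent k ] Descent.X d′ ⊂ X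
  peel {k} {t} {u} d t∈X extreme u∈X u≢t = d′ , ∖-⊂ t∈X (x∈⁅x⁆ t)
    where
    open Descent d

    settled′ : ∀ s y → s ∈ W → s ∉ X ∖ ⁅ t ⁆ → y ∈ W → Comparable s y
    settled′ s y s∈W s∉X′ y∈W with s ∈? X | s ≟ t | y ∈? X
    ... | no s∉X | _ | _ = settled s y s∈W s∉X y∈W
    ... | yes s∈X | no s≢t | _ = contradiction (∖-⁅⁆⁺ s∈X s≢t) s∉X′
    ... | yes _ | yes refl | yes y∈X = extreme-comparable X-module t∈X extreme y∈X
    ... | yes _ | yes refl | no y∉X = ⊎-swap (settled y s y∈W y∉X (X⊆W t∈X))

    d′ : Descent k
    d′ = record d
      { X = X ∖ ⁅ t ⁆ ; X⊆W = X⊆W ∘ proj₁ ∘ ∖-⁅⁆⁻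
      ; X-module = module-minus-extreme X-module extreme ; settled = settled′
      ; x₀ = u ; x₀∈X = ∖-⁅⁆⁺ u∈X u≢t }

  module _ (cograph : Cograph G) where

    -- The pairs v–y, y–o, o–z with adjacency β and v–o, y–z, v–z with
    -- adjacency (not β) would form an induced P4 v-y-o-z in G (β = true) or
    -- y-z-v-o in G (β = false).
    no-alternating-P4 : ∀ β {v y z o} →
                        adj G v y ≡ β → adj G y o ≡ β → adj G z o ≡ β →
                        adj G v o ≡ not β → adj G y z ≡ not β → adj G v z ≡ not β → ⊥
    no-alternating-P4 true {v} {y} {z} {o} vy yo zo vo yz vz =
      cograph v y o z (vy , yo , trans (adj-sym o z) zo , vo , yz , vz)
    no-alternating-P4 false {v} {y} {z} {o} vy yo zo vo yz vz =
      cograph y z v o (yz , trans (adj-sym z v) vz , vo , trans (adj-sym y v) vy , zo , yo)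

    module Extend {X : Subset n} {v : Fin n} (v∈X : v ∈ X)
                  (s : HomogeneousSplit (X ∖ ⁅ v ⁆)) where
      open HomogeneousSplit s

      X′ : Subset n
      X′ = X ∖ ⁅ v ⁆

      X′⊆X : X′ ⊆ X
      X′⊆X = proj₁ ∘ ∖-⁅⁆⁻

      join-A : (∀ p → p ∈ X′ → p ∉ A → adj G v p ≡ β) → HomogeneousSplit X
      join-A v-across = record
        { A = A ∪ ⁅ v ⁆ ; A⊆X = A∪v⊆X ; a = a ; a∈A = x∈p∪q⁺ (inj₁ a∈A)
        ; b = b ; b∈X = X′⊆X b∈X ; b∉A = b∉A∪v ; β = β ; across = across′ }
        where
        ∉A∪v : z ∉ A ∪ ⁅ v ⁆ → z ∉ A × z ≢ v
        ∉A∪v z∉ = (z∉ ∘ x∈p∪q⁺ ∘ inj₁) , λ { refl → z∉ (x∈p∪q⁺ (inj₂ (x∈⁅x⁆ v))) }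

        A∪v⊆X : A ∪ ⁅ v ⁆ ⊆ X
        A∪v⊆X {y} y∈ with x∈p∪q⁻ A ⁅ v ⁆ y∈
        ... | inj₁ y∈A = X′⊆X (A⊆X y∈A)
        ... | inj₂ y∈v with x∈⁅y⁆⇒x≡y v y∈v
        ...   | refl = v∈X

        b∉A∪v : b ∉ A ∪ ⁅ v ⁆
        b∉A∪v b∈ with x∈p∪q⁻ A ⁅ v ⁆ b∈
        ... | inj₁ b∈A = b∉A b∈A
        ... | inj₂ b∈v = proj₂ (∖-⁅⁆⁻ b∈X) (x∈⁅y⁆⇒x≡y v b∈v)

        across′ : ∀ y z → y ∈ A ∪ ⁅ v ⁆ → z ∈ X → z ∉ A ∪ ⁅ v ⁆ → adj G y z ≡ β
        across′ y z y∈ z∈X z∉ with ∉A∪v z∉ | x∈p∪q⁻ A ⁅ v ⁆ y∈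
        ... | z∉A , z≢v | inj₁ y∈A = across y z y∈A (∖-⁅⁆⁺ z∈X z≢v) z∉A
        ... | z∉A , z≢v | inj₂ y∈v with x∈⁅y⁆⇒x≡y v y∈v
        ...   | refl = v-across z (∖-⁅⁆⁺ z∈X z≢v) z∉A

      join-rest : (∀ q → q ∈ A → adj G v q ≡ β) → HomogeneousSplit X
      join-rest v-A = record
        { A = A ; A⊆X = X′⊆X ∘ A⊆X ; a = a ; a∈A = a∈A
        ; b = b ; b∈X = X′⊆X b∈X ; b∉A = b∉A ; β = β ; across = across′ }
        where
        across′ : ∀ y z → y ∈ A → z ∈ X → z ∉ A → adj G y z ≡ β
        across′ y z y∈A z∈X z∉A with z ≟ v
        ... | yes refl = trans (adj-sym y z) (v-A y y∈A)
        ... | no z≢v = across y z y∈A (∖-⁅⁆⁺ z∈X z≢v) z∉A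

      alone : (∀ z → z ∈ X′ → adj G v z ≡ not β) → HomogeneousSplit X
      alone v-X′ = record
        { A = ⁅ v ⁆ ; A⊆X = v⊆X ; a = v ; a∈A = x∈⁅x⁆ v
        ; b = a ; b∈X = X′⊆X (A⊆X a∈A) ; b∉A = x≢y⇒x∉⁅y⁆ (proj₂ (∖-⁅⁆⁻ (A⊆X a∈A)))
        ; β = not β ; across = across′ }
        where
        v⊆X : ⁅ v ⁆ ⊆ X
        v⊆X y∈v with x∈⁅y⁆⇒x≡y v y∈v
        ... | refl = v∈X

        across′ : ∀ y z → y ∈ ⁅ v ⁆ → z ∈ X → z ∉ ⁅ v ⁆ → adj G y z ≡ not β
        across′ y z y∈v z∈X z∉v with x∈⁅y⁆⇒x≡y v y∈v
        ... | refl = v-X′ z (∖⁺ z∈X z∉v)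

      -- Otherwise v has neighbours of both kinds on both sides, and (no
      -- alternating P4) the vertices joined to v like A is joined to X′ ∖ A
      -- form a part, against everything else together with v.
      regroup : ∀ {p q z₀} → p ∈ X′ → p ∉ A → adj G v p ≡ not β →
                q ∈ A → adj G v q ≡ not β → z₀ ∈ X′ → adj G v z₀ ≡ β →
                HomogeneousSplit X
      regroup {p} {q} {z₀} p∈X′ p∉A vp q∈A vq z₀∈X′ vz₀ = record
        { A = A′ ; A⊆X = X′⊆X ∘ proj₁ ∘ A′⁻ ; a = z₀ ; a∈A = A′⁺ z₀∈X′ vz₀
        ; b = v ; b∈X = v∈X ; b∉A = λ v∈A′ → proj₂ (∖-⁅⁆⁻ (proj₁ (A′⁻ v∈A′))) refl
        ; β = β ; across = across′ }
        where
        A′ : Subset n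
        A′ = X′ ∩ select (λ y → adj G v y ≟ᵇ β)

        A′⁺ : y ∈ X′ → adj G v y ≡ β → y ∈ A′
        A′⁺ y∈X′ vy = x∈p∩q⁺ (y∈X′ , select⁺ (λ y → adj G v y ≟ᵇ β) vy)

        A′⁻ : y ∈ A′ → y ∈ X′ × adj G v y ≡ β
        A′⁻ {y} y∈A′ with x∈p∩q⁻ X′ _ y∈A′
        ... | y∈X′ , y∈sel = y∈X′ , select⁻ (λ y → adj G v y ≟ᵇ β) y∈sel

        -- y, z on the same side of the old split: a common other-side
        -- vertex o that v sees as (not β) rules out adj y z ≡ not β.
        same-side : ∀ {y z} o → adj G v y ≡ β → adj G v z ≡ not β →
                    adj G y o ≡ β → adj G z o ≡ β → adj G v o ≡ not β → adj G y z ≡ β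
        same-side {y} {z} o vy vz yo zo vo = decidable-stable (adj G y z ≟ᵇ β)
          λ yz≢β → no-alternating-P4 β vy yo zo vo (¬-not yz≢β) vz

        across′ : ∀ y z → y ∈ A′ → z ∈ X → z ∉ A′ → adj G y z ≡ β
        across′ y z y∈A′ z∈X z∉A′ with A′⁻ y∈A′ | z ≟ v
        ... | _ , vy | yes refl = trans (adj-sym y z) vy
        ... | y∈X′ , vy | no z≢v with ∖-⁅⁆⁺ z∈X z≢v
        ...   | z∈X′ with ¬-not (λ vz → z∉A′ (A′⁺ z∈X′ vz)) | y ∈? A | z ∈? A
        ...     | vz | yes y∈A | no z∉A = across y z y∈A z∈X′ z∉A
        ...     | vz | no y∉A | yes z∈A = trans (adj-sym y z) (across z y z∈A y∈X′ y∉A)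
        ...     | vz | yes y∈A | yes z∈A =
          same-side p vy vz (across y p y∈A p∈X′ p∉A) (across z p z∈A p∈X′ p∉A) vp
        ...     | vz | no y∉A | no z∉A =
          same-side q vy vz (trans (adj-sym y q) (across q y q∈A y∈X′ y∉A))
                            (trans (adj-sym z q) (across q z q∈A z∈X′ z∉A)) vq

      extend : HomogeneousSplit X
      extend with any? (λ p → p ∈? X′ ×-dec ¬? (p ∈? A) ×-dec ¬? (adj G v p ≟ᵇ β))
                | any? (λ q → q ∈? A ×-dec ¬? (adj G v q ≟ᵇ β))
                | any? (λ z → z ∈? X′ ×-dec adj G v z ≟ᵇ β)
      ... | no none | _ | _ = join-A λ p p∈X′ p∉A →
        decidable-stable (adj G v p ≟ᵇ β) λ vp≢β → none (p , p∈X′ , p∉A , vp≢β)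
      ... | yes _ | no none | _ = join-rest λ q q∈A →
        decidable-stable (adj G v q ≟ᵇ β) λ vq≢β → none (q , q∈A , vq≢β)
      ... | yes _ | yes _ | no none = alone λ z z∈X′ → ¬-not λ vz → none (z , z∈X′ , vz)
      ... | yes (p , p∈X′ , p∉A , vp) | yes (q , q∈A , vq) | yes (z₀ , z₀∈X′ , vz₀) =
        regroup p∈X′ p∉A (¬-not vp) q∈A (¬-not vq) z₀∈X′ vz₀

    cograph-split : ∀ X → Acc _⊂_ X → u ∈ X → v ∈ X → u ≢ v → HomogeneousSplit X
    cograph-split {u} {v} X (acc smaller) u∈X v∈X u≢v
      with any? (λ w → w ∈? X ∖ ⁅ v ⁆ ×-dec ¬? (w ≟ u))
    ... | yes (w , w∈X′ , w≢u) =
      Extend.extend v∈X (cograph-split (X ∖ ⁅ v ⁆) (smaller (∖-⊂ v∈X (x∈⁅x⁆ v)))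
                                       (∖-⁅⁆⁺ u∈X u≢v) w∈X′ (w≢u ∘ sym))
    ... | no only-u = record
      { A = ⁅ u ⁆ ; A⊆X = u⊆X ; a = u ; a∈A = x∈⁅x⁆ u
      ; b = v ; b∈X = v∈X ; b∉A = x≢y⇒x∉⁅y⁆ (u≢v ∘ sym) ; β = adj G u v ; across = across }
      where
      u⊆X : ⁅ u ⁆ ⊆ X
      u⊆X y∈u with x∈⁅y⁆⇒x≡y u y∈u
      ... | refl = u∈X

      across : ∀ y z → y ∈ ⁅ u ⁆ → z ∈ X → z ∉ ⁅ u ⁆ → adj G y z ≡ adj G u v
      across y z y∈u z∈X z∉u with x∈⁅y⁆⇒x≡y u y∈u | z ≟ v
      ... | refl | yes refl = refl
      ... | refl | no z≢v = contradiction (z , ∖-⁅⁆⁺ z∈X z≢v , x∉⁅y⁆⇒x≢y z∉u) only-u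

    -- Without extreme vertices in G[X], a homogeneous split X = A ∪ (X ∖ A)
    -- has no comparabilities across.  The settled vertices take the colour
    -- of a vertex a of A; then X ∖ A is a union of colour classes and becomes
    -- both the new W and the new X.
    descend : (d : Descent k) → let open Descent d in
              (∀ t → t ∈ X → ¬ Extreme X t) → u ∈ X → v ∈ X → ¬ Comparable u v →
              Σ[ d′ ∈ Descent k ] Descent.X d′ ⊂ X
    descend {k} {u} {v} d no-extreme u∈X v∈X incomparable = d′ , ∖-⊂ (A⊆X a∈A) a∈A
      where
      open Descent d

      split : HomogeneousSplit X
      split = cograph-split X (⊂-wellFounded X) u∈X v∈X
                λ { refl → incomparable (comparable-refl u) }
      open HomogeneousSplit split

      Settled : Subset n
      Settled = W ∖ X

      colour′ : Fin n → Fin k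
      colour′ = recolour Settled (colour a) colour

      colour′-chains : IsChainCover colour′
      colour′-chains = recolour-chains colour colour-chains
        (λ r s r∈ s∈ → settled r s (proj₁ (∖⁻ r∈)) (proj₂ (∖⁻ r∈)) (proj₁ (∖⁻ s∈)))
        (λ r w r∈ same → settled r w (proj₁ (∖⁻ r∈)) (proj₂ (∖⁻ r∈))
                           (W-closed a w (sym same) (X⊆W (A⊆X a∈A))))

      unsettled : ∀ {w} → w ∈ W → w ∉ Settled → w ∈ X
      unsettled {w} w∈W w∉S = decidable-stable (w ∈? X) λ w∉X → w∉S (∖⁺ w∈W w∉X)

      B-closed : ColourClosed colour′ (X ∖ A)
      B-closed y w same y∈B with ∖⁻ y∈B
      ... | y∈X , y∉A = by-settled (w ∈? Settled)
        where
        y-incomparable-A : ∀ z → z ∈ A → ¬ colour z ≡ colour y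
        y-incomparable-A z z∈A same-colour =
          split-incomparable split no-extreme z y z∈A y∈X y∉A (colour-chains z y same-colour)

        colour′-y : colour′ y ≡ colour y
        colour′-y = recolour-∉ colour λ y∈S → proj₂ (∖⁻ y∈S) y∈X

        by-settled : Dec (w ∈ Settled) → w ∈ X ∖ A
        by-settled (yes w∈S) =
          contradiction (trans (sym (recolour-∈ colour w∈S)) (trans (sym same) colour′-y))
                        (y-incomparable-A a a∈A)
        by-settled (no w∉S) = ∖⁺ w∈X (λ w∈A → y-incomparable-A w w∈A (sym colour-y≡w))
          where
          colour-y≡w : colour y ≡ colour w
          colour-y≡w = trans (sym colour′-y) (trans same (recolour-∉ colour w∉S))

          w∈X : w ∈ X
          w∈X = unsettled (W-closed y w colour-y≡w (X⊆W y∈X)) w∉S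

      d′ : Descent k
      d′ = record
        { colour = colour′ ; colour-chains = colour′-chains ; W = X ∖ A ; X = X ∖ A
        ; X⊆W = λ y∈B → y∈B ; W-module = split-module split X-module ; W-closed = B-closed
        ; X-module = split-module split X-module
        ; settled = λ s _ s∈B s∉B _ → contradiction s∈B s∉B ; x₀ = b ; x₀∈X = ∖⁺ b∈X b∉A }

    search : (d : Descent k) → Acc _⊂_ (Descent.X d) → ModularChain k
    search {k} d (acc smaller) = on-incomparable-pair (incomparable-pair? X)
      where
      open Descent d

      continue : Σ[ d′ ∈ Descent k ] Descent.X d′ ⊂ X → ModularChain k
      continue (d′ , shrunk) = search d′ (smaller shrunk)

      on-incomparable-pair : Dec (∃[ u ] ∃[ v ] (u ∈ X × v ∈ X × ¬ Comparable u v)) →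
                             ModularChain k
      on-incomparable-pair (no X-chain) = finish d λ u v u∈X v∈X →
        decidable-stable (comparable? u v) λ incomparable →
          X-chain (u , v , u∈X , v∈X , incomparable)
      on-incomparable-pair (yes (u , v , u∈X , v∈X , incomparable)) =
        on-extreme-vertex (extreme-vertex? X)
        where
        on-extreme-vertex : Dec (∃[ t ] (t ∈ X × Extreme X t)) → ModularChain k
        on-extreme-vertex (yes (t , t∈X , extreme)) = continue (peel d t∈X extreme u∈X u≢t)
          where
          u≢t : u ≢ t
          u≢t refl = incomparable (extreme-comparable X-module t∈X extreme v∈X)
        on-extreme-vertex (no none) = continue
          (descend d (λ t t∈X extreme → none (t , t∈X , extreme)) u∈X v∈X incomparable)

    modular-chain : (c : Fin n → Fin k) → IsChainCover c → Fin n → ModularChain k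
    modular-chain c chains x₀ = search (start c chains x₀) (⊂-wellFounded ⊤)

some-vertex : ∀ {n k} (G : Graph (Fin n)) → (∀ m → m < k → ¬ ChainCover G m) → 0 < k → Fin n
some-vertex {zero} G minimum 0<k = ⊥-elim (minimum 0 0<k ((λ ()) , λ ()))
some-vertex {suc n} G minimum 0<k = zero

lemma3p3 : ∀ {n : ℕ} (G : Graph (Fin n)) (k : ℕ) →
    Cograph G → DilworthNumber G k → 2 ≤ k →
    Σ[ p ∈ (Fin n → Fin k) ]
      (Surjective _≡_ _≡_ p ×
       (∀ (i : Fin k) → Threshold (induced G (λ v → p v ≡ i))) ×
       (∃[ i ] (∀ (u w : Fin n) → p u ≡ i → p w ≡ i →
                 ∀ (x : Fin n) → ¬ p x ≡ i → adj G u x ≡ adj G w x)))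
lemma3p3 G k cograph ((c , chains) , minimum) 2≤k =
  let x₀ = some-vertex G minimum (<-≤-trans (s≤s z≤n) 2≤k)
      p , p-chains , module-class = collapse G (modular-chain G cograph c chains x₀)
  in p , minimum-cover-surjective G minimum p p-chains ,
         chainCover-threshold G cograph p p-chains , module-class
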